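{- Let $K=\mathbb{Q}(\sqrt{D})$ where $D\in\{ -3,-11,-19,-43,-67,-163\}$. Let $p$ be a prime that splits in $K$, and let $p=\alpha\bar\alpha$ be a factorization with $\alpha,\bar\alpha\in\mathcal{O}_K$ such that $\alpha\mathcal{O}_K$ and $\bar\alpha\mathcal{O}_K$ are the prime ideals above $p$. Let $\nu$ be the valuation extending the $2$-adic valuation, with completion $K_\nu\cong\mathbb{Q}_2(\zeta_3)$ and valuation ring $A_\nu$. Then $(x-\alpha^3)(x-\bar\alpha^3)$ is congruent modulo $8A_\nu$ to one of \[ x^2\pm 2x+1,\quad x^2+3,\quad x^2\pm 2x+5,\quad x^2+4x+7, \] and $(x-\alpha^3)(x+\bar\alpha^3)$ is congruent modulo $8A_\nu$ to one of \[ x^2+7,\quad x^2+(4\zeta_3\pm 2)x+5,\quad x^2+4x+3,\quad x^2+(4\zeta_3\pm2)x+1. \]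
   Context: $\zeta_3$ denotes a root of $x^2+x+1$ in $K_\nu$ (which exists since $2$ is inert in $K$). Congruence of polynomials modulo $8A_\nu$ is coefficientwise. -}

module Defs where

open import Data.Nat using (ℕ)
open import Data.Integer using (ℤ; +_; -[1+_]; _+_; _-_; _*_; -_)
open import Data.Integer.DivMod using (_/ℕ_)
open import Data.List using (List; _∷_; [])
open import Data.Product using (Σ; _×_; _,_; ∃)
open import Data.Sum using (_⊎_)
open import Relation.Nullary using (¬_)
open import Relation.Binary.PropositionalEquality using (_≡_)

heegnerDs : List ℤ
heegnerDs = -[1+ 2 ] ∷ -[1+ 10 ] ∷ -[1+ 18 ] ∷ -[1+ 42 ] ∷ -[1+ 66 ] ∷ -[1+ 162 ] ∷ []

-- Elements of O_K = ℤ[ω], ω = (1 + √D)/2; mk a b stands for a + b·ω.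
record 𝒪 : Set where
  constructor mk
  field
    re : ℤ
    im : ℤ
open 𝒪 public

-- Ring structure of O_K = ℤ[ω] for K = ℚ(√D), D ≡ 1 (mod 4):
-- ω² = ω + (D - 1)/4.
module OK (D : ℤ) where

  c : ℤ
  c = (D - + 1) /ℕ 4

  infixl 6 _+ᴷ_ _-ᴷ_
  infixl 7 _*ᴷ_

  ι : ℤ → 𝒪
  ι n = mk n (+ 0)

  ω : 𝒪
  ω = mk (+ 0) (+ 1)

  _+ᴷ_ : 𝒪 → 𝒪 → 𝒪
  mk a b +ᴷ mk a' b' = mk (a + a') (b + b')

  -ᴷ_ : 𝒪 → 𝒪
  -ᴷ mk a b = mk (- a) (- b)

  _-ᴷ_ : 𝒪 → 𝒪 → 𝒪
  x -ᴷ y = x +ᴷ (-ᴷ y)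

  _*ᴷ_ : 𝒪 → 𝒪 → 𝒪
  mk a b *ᴷ mk a' b' = mk (a * a' + b * b' * c) (a * b' + a' * b + b * b')

  cube : 𝒪 → 𝒪
  cube x = x *ᴷ x *ᴷ x

  _∣ᴷ_ : 𝒪 → 𝒪 → Set
  x ∣ᴷ y = ∃ λ q → y ≡ x *ᴷ q

  IsUnit : 𝒪 → Set
  IsUnit x = x ∣ᴷ ι (+ 1)

  PrincipalPrime : 𝒪 → Set
  PrincipalPrime x = ¬ IsUnit x × (∀ y z → x ∣ᴷ (y *ᴷ z) → (x ∣ᴷ y) ⊎ (x ∣ᴷ z))

  SameIdeal : 𝒪 → 𝒪 → Set
  SameIdeal x y = (x ∣ᴷ y) × (y ∣ᴷ x)

  _≡₈_ : 𝒪 → 𝒪 → Set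
  x ≡₈ y = ι (+ 8) ∣ᴷ (x -ᴷ y)

  -- monic quadratic x² + b x + c represented by (b , c)
  Quad : Set
  Quad = 𝒪 × 𝒪

  -- (x - r)(x - s) = x² - (r + s) x + r s
  linProd : 𝒪 → 𝒪 → Quad
  linProd r s = (-ᴷ (r +ᴷ s)) , (r *ᴷ s)

  _≡Q₈_ : Quad → Quad → Set
  (b , c₀) ≡Q₈ (b' , c₀') = (b ≡₈ b') × (c₀ ≡₈ c₀')

  k : ℤ → 𝒪
  k n = ι n

  list₁ : List Quad
  list₁ = (k (+ 2) , k (+ 1)) ∷ (k (- + 2) , k (+ 1)) ∷ (k (+ 0) , k (+ 3))
        ∷ (k (+ 2) , k (+ 5)) ∷ (k (- + 2) , k (+ 5)) ∷ (k (+ 4) , k (+ 7)) ∷ []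

  -- x²+7, x²+(4ζ±2)x+5, x²+4x+3, x²+(4ζ±2)x+1, with ζ given by z
  list₂ : 𝒪 → List Quad
  list₂ z = (k (+ 0) , k (+ 7))
          ∷ (ι (+ 4) *ᴷ z +ᴷ k (+ 2) , k (+ 5)) ∷ (ι (+ 4) *ᴷ z -ᴷ k (+ 2) , k (+ 5))
          ∷ (k (+ 4) , k (+ 3))
          ∷ (ι (+ 4) *ᴷ z +ᴷ k (+ 2) , k (+ 1)) ∷ (ι (+ 4) *ᴷ z -ᴷ k (+ 2) , k (+ 1)) ∷ []

{-# OPTIONS --safe #-}
-- Let N(a + bω) = a² + ab − c b² be the norm, where ω² = ω + c and c = (D − 1)/4 ≤ −1. It is
-- multiplicative, x · conj x = N x, and N ≥ 0 because K is imaginary. From α ᾱ = p with neither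
-- factor a unit, N α · N ᾱ = p² forces N α = p and then ᾱ = conj α. Both quadratics therefore
-- depend only on α modulo 8 and, since ζ₃ enters only as 4ζ₃, on ζ₃ modulo 2: the statement becomes
-- a finite check over residues, decided by evaluation for each of the six discriminants. The check
-- needs N α odd, which holds because 2 is inert: no norm is 2 modulo 8, so p ≠ 2.
module Submission where

open import Defs
open import Data.Nat as ℕ using (ℕ; z≤n)
import Data.Nat.Properties as ℕ
import Data.Nat.Divisibility as ℕ
open import Data.Nat.Primality using (Prime; euclidsLemma; prime⇒irreducible; prime⇒nonZero)
open import Data.Integer using (ℤ; NonZero; +_; -[1+_]; _+_; _-_; _*_; -_; ∣_∣; _≤_; +≤+; 0ℤ; -1ℤ)
import Data.Integer.Properties as ℤ
open import Data.Integer.DivMod using (_%_; _/_; a≡a%n+[a/n]*n; n%d<d)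
open import Data.Integer.Divisibility.Signed
  using (_∣_; divides; _∣?_; ∣⇒∣ᵤ; ∣-trans; ∣m∣n⇒∣m+n; ∣n⇒∣m*n; ∣m⇒∣m*n; ∣m⇒∣-m; *-monoʳ-∣)
open import Data.Integer.Tactic.RingSolver using (solve-∀)
open import Data.Fin using (Fin; toℕ; fromℕ<)
import Data.Fin.Properties as Fin
open import Data.List.Membership.Propositional using (_∈_)
open import Data.List.Relation.Unary.Any as Any using (Any; any?)
open import Data.List.Relation.Unary.All as All using (All)
open import Data.List.Relation.Binary.Pointwise using (Pointwise; []; _∷_; Any-resp-Pointwise)
open import Data.Product using (_×_; _,_; proj₁; proj₂; ∃₂; uncurry)
open import Data.Sum using (inj₁; inj₂)
open import Relation.Nullary using (¬_; Dec; ¬?; _×-dec_; _→-dec_; contradiction)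
open import Relation.Nullary.Decidable as Dec using (from-yes)
open import Relation.Binary.PropositionalEquality
open import Function using (case_of_)
open import Algebra.Properties.CommutativeSemigroup ℕ.*-commutativeSemigroup using (xy∙z≈xz∙y)

-- Congruences

infix 4 _≡_[mod_] _≡ᴷ_[mod_] _≡ᴾ_[mod_] _≡?_[mod_] _≡ᴷ?_[mod_] _≡ᴾ?_[mod_]

-- A record rather than a synonym for m ∣ a - b, so that a and b can be inferred from a proof.
record _≡_[mod_] (a b m : ℤ) : Set where
  constructor congruent
  field divides-difference : m ∣ a - b

_≡?_[mod_] : ∀ a b m → Dec (a ≡ b [mod m ])
a ≡? b [mod m ] = Dec.map′ congruent _≡_[mod_].divides-difference (m ∣? a - b)

module _ {m : ℤ} where

  ≡-mod-refl : ∀ a → a ≡ a [mod m ]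
  ≡-mod-refl a = congruent (divides 0ℤ (cancel a m))
    where cancel : ∀ a m → a - a ≡ 0ℤ * m
          cancel = solve-∀

  ≡-mod-reflexive : ∀ {a b} → a ≡ b → a ≡ b [mod m ]
  ≡-mod-reflexive {a} refl = ≡-mod-refl a

  ≡-mod-sym : ∀ {a b} → a ≡ b [mod m ] → b ≡ a [mod m ]
  ≡-mod-sym {a} {b} (congruent m∣a-b) = congruent (subst (m ∣_) (negate a b) (∣m⇒∣-m m∣a-b))
    where negate : ∀ a b → - (a - b) ≡ b - a
          negate = solve-∀

  ≡-mod-trans : ∀ {a b c} → a ≡ b [mod m ] → b ≡ c [mod m ] → a ≡ c [mod m ]
  ≡-mod-trans {a} {b} {c} (congruent m∣a-b) (congruent m∣b-c) =
    congruent (subst (m ∣_) (telescope a b c) (∣m∣n⇒∣m+n m∣a-b m∣b-c))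
    where telescope : ∀ a b c → (a - b) + (b - c) ≡ a - c
          telescope = solve-∀

  +-cong-mod : ∀ {a b a′ b′} → a ≡ b [mod m ] → a′ ≡ b′ [mod m ] → a + a′ ≡ b + b′ [mod m ]
  +-cong-mod {a} {b} {a′} {b′} (congruent m∣a-b) (congruent m∣a′-b′) =
    congruent (subst (m ∣_) (regroup a b a′ b′) (∣m∣n⇒∣m+n m∣a-b m∣a′-b′))
    where regroup : ∀ a b a′ b′ → (a - b) + (a′ - b′) ≡ (a + a′) - (b + b′)
          regroup = solve-∀

  neg-cong-mod : ∀ {a b} → a ≡ b [mod m ] → - a ≡ - b [mod m ]
  neg-cong-mod {a} {b} (congruent m∣a-b) = congruent (subst (m ∣_) (negate a b) (∣m⇒∣-m m∣a-b))
    where negate : ∀ a b → - (a - b) ≡ - a - - b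
          negate = solve-∀

  *-cong-mod : ∀ {a b a′ b′} → a ≡ b [mod m ] → a′ ≡ b′ [mod m ] → a * a′ ≡ b * b′ [mod m ]
  *-cong-mod {a} {b} {a′} {b′} (congruent m∣a-b) (congruent m∣a′-b′) =
    congruent (subst (m ∣_) (regroup a b a′ b′) (∣m∣n⇒∣m+n (∣m⇒∣m*n a′ m∣a-b) (∣n⇒∣m*n b m∣a′-b′)))
    where regroup : ∀ a b a′ b′ → (a - b) * a′ + b * (a′ - b′) ≡ a * a′ - b * b′
          regroup = solve-∀

*-scale-mod : ∀ k {m a b} → a ≡ b [mod m ] → k * a ≡ k * b [mod k * m ]
*-scale-mod k {m} {a} {b} (congruent m∣a-b) = congruent (subst (k * m ∣_) (distrib k a b) (*-monoʳ-∣ k m∣a-b))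
  where distrib : ∀ k a b → k * (a - b) ≡ k * a - k * b
        distrib = solve-∀

≡-mod-weaken : ∀ {n m a b} → n ∣ m → a ≡ b [mod m ] → a ≡ b [mod n ]
≡-mod-weaken n∣m (congruent m∣a-b) = congruent (∣-trans n∣m m∣a-b)

≡-mod-% : ∀ a m .{{_ : NonZero m}} → a ≡ + (a % m) [mod m ]
≡-mod-% a m = congruent (divides (a / m) (begin
  a - + (a % m)                       ≡⟨ cong (_- + (a % m)) (a≡a%n+[a/n]*n a m) ⟩
  + (a % m) + (a / m) * m - + (a % m) ≡⟨ cancel (+ (a % m)) (a / m) m ⟩
  (a / m) * m                         ∎))
  where
  open ≡-Reasoning
  cancel : ∀ r q m → r + q * m - r ≡ q * m
  cancel = solve-∀

record _≡ᴷ_[mod_] (x y : 𝒪) (m : ℤ) : Set where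
  constructor ⟨_,_⟩
  field
    re-congruent : re x ≡ re y [mod m ]
    im-congruent : im x ≡ im y [mod m ]

record _≡ᴾ_[mod_] (P Q : 𝒪 × 𝒪) (m : ℤ) : Set where
  constructor ⟨_,_⟩
  field
    linear-congruent   : proj₁ P ≡ᴷ proj₁ Q [mod m ]
    constant-congruent : proj₂ P ≡ᴷ proj₂ Q [mod m ]

_≡ᴷ?_[mod_] : ∀ x y m → Dec (x ≡ᴷ y [mod m ])
x ≡ᴷ? y [mod m ] = Dec.map′ (uncurry ⟨_,_⟩) (λ { ⟨ p , q ⟩ → p , q })
  (re x ≡? re y [mod m ] ×-dec im x ≡? im y [mod m ])

_≡ᴾ?_[mod_] : ∀ P Q m → Dec (P ≡ᴾ Q [mod m ])
P ≡ᴾ? Q [mod m ] = Dec.map′ (uncurry ⟨_,_⟩) (λ { ⟨ p , q ⟩ → p , q })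
  (proj₁ P ≡ᴷ? proj₁ Q [mod m ] ×-dec proj₂ P ≡ᴷ? proj₂ Q [mod m ])

module _ {m : ℤ} where

  ≡ᴷ-mod-refl : ∀ x → x ≡ᴷ x [mod m ]
  ≡ᴷ-mod-refl x = ⟨ ≡-mod-refl (re x) , ≡-mod-refl (im x) ⟩

  ≡ᴷ-mod-sym : ∀ {x y} → x ≡ᴷ y [mod m ] → y ≡ᴷ x [mod m ]
  ≡ᴷ-mod-sym ⟨ re≡ , im≡ ⟩ = ⟨ ≡-mod-sym re≡ , ≡-mod-sym im≡ ⟩

  ≡ᴷ-mod-trans : ∀ {x y z} → x ≡ᴷ y [mod m ] → y ≡ᴷ z [mod m ] → x ≡ᴷ z [mod m ]
  ≡ᴷ-mod-trans ⟨ re≡ , im≡ ⟩ ⟨ re≡′ , im≡′ ⟩ = ⟨ ≡-mod-trans re≡ re≡′ , ≡-mod-trans im≡ im≡′ ⟩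

  ≡ᴾ-mod-refl : ∀ P → P ≡ᴾ P [mod m ]
  ≡ᴾ-mod-refl P = ⟨ ≡ᴷ-mod-refl (proj₁ P) , ≡ᴷ-mod-refl (proj₂ P) ⟩

  ≡ᴾ-mod-trans : ∀ {P Q R} → P ≡ᴾ Q [mod m ] → Q ≡ᴾ R [mod m ] → P ≡ᴾ R [mod m ]
  ≡ᴾ-mod-trans ⟨ b≡ , c≡ ⟩ ⟨ b≡′ , c≡′ ⟩ = ⟨ ≡ᴷ-mod-trans b≡ b≡′ , ≡ᴷ-mod-trans c≡ c≡′ ⟩

≡ᴷ-mod-weaken : ∀ {n m x y} → n ∣ m → x ≡ᴷ y [mod m ] → x ≡ᴷ y [mod n ]
≡ᴷ-mod-weaken n∣m ⟨ re≡ , im≡ ⟩ = ⟨ ≡-mod-weaken n∣m re≡ , ≡-mod-weaken n∣m im≡ ⟩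

2∣8 : + 2 ∣ + 8
2∣8 = divides (+ 4) refl

residue : ∀ {n} → Fin n → Fin n → 𝒪
residue r s = mk (+ toℕ r) (+ toℕ s)

residue-of : ∀ n .{{_ : ℕ.NonZero n}} x → ∃₂ λ (r s : Fin n) → x ≡ᴷ residue r s [mod + n ]
residue-of n x = digit (re x) , digit (im x) , ⟨ ≡-digit (re x) , ≡-digit (im x) ⟩
  where
  digit : ℤ → Fin n
  digit a = fromℕ< (n%d<d a (+ n))
  ≡-digit : ∀ a → a ≡ + toℕ (digit a) [mod + n ]
  ≡-digit a = subst (λ r → a ≡ + r [mod + n ]) (sym (Fin.toℕ-fromℕ< _)) (≡-mod-% a (+ n))

0≤i*i : ∀ i → 0ℤ ≤ i * i
0≤i*i (+ n)    = subst (0ℤ ≤_) (ℤ.pos-* n n) (+≤+ z≤n)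
0≤i*i -[1+ n ] = +≤+ z≤n

0≤i*j : ∀ {i j} → 0ℤ ≤ i → 0ℤ ≤ j → 0ℤ ≤ i * j
0≤i*j (+≤+ {n = m} _) (+≤+ {n = n} _) = subst (0ℤ ≤_) (ℤ.pos-* m n) (+≤+ z≤n)

0≤2*i⇒0≤i : ∀ {i} → 0ℤ ≤ + 2 * i → 0ℤ ≤ i
0≤2*i⇒0≤i {+ n}     _  = +≤+ z≤n
0≤2*i⇒0≤i { -[1+ n ]} ()

factor-divisible-by-prime : ∀ {p m n} → Prime p → p ℕ.∣ m → m ℕ.* n ≡ p ℕ.* p → n ≢ 1 → m ≡ p
factor-divisible-by-prime {p} {n = n} p-prime (ℕ.divides q refl) qp*n≡p*p n≢1 =
  case prime⇒irreducible p-prime q∣p of λ where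
    (inj₁ refl) → ℕ.*-identityˡ p
    (inj₂ refl) → contradiction (ℕ.*-cancelˡ-≡ n 1 p (trans q*n≡p (sym (ℕ.*-identityʳ p)))) n≢1
  where
  instance _ = prime⇒nonZero p-prime
  q*n≡p : q ℕ.* n ≡ p
  q*n≡p = ℕ.*-cancelʳ-≡ (q ℕ.* n) p p (trans (xy∙z≈xz∙y q n p) qp*n≡p*p)
  q∣p : q ℕ.∣ p
  q∣p = ℕ.divides n (trans (sym q*n≡p) (ℕ.*-comm q n))

prime-square-factor : ∀ {p m n} → Prime p → m ℕ.* n ≡ p ℕ.* p → m ≢ 1 → n ≢ 1 → m ≡ p
prime-square-factor {p} {m} {n} p-prime m*n≡p*p m≢1 n≢1
  with euclidsLemma m n p-prime (ℕ.divides p m*n≡p*p)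
... | inj₁ p∣m = factor-divisible-by-prime p-prime p∣m m*n≡p*p n≢1
... | inj₂ p∣n = ℕ.*-cancelʳ-≡ m p p {{prime⇒nonZero p-prime}} (subst (λ k → m ℕ.* k ≡ p ℕ.* p) n≡p m*n≡p*p)
  where n≡p = factor-divisible-by-prime p-prime p∣n (trans (ℕ.*-comm n m) m*n≡p*p) m≢1

even-prime≡2 : ∀ {p} → Prime p → 2 ℕ.∣ p → p ≡ 2
even-prime≡2 p-prime 2∣p with prime⇒irreducible p-prime 2∣p
... | inj₂ 2≡p = sym 2≡p

-- ℤ[ω] with ω² = ω + c

module RingOfIntegers (D : ℤ) where
  open OK D

  conj : 𝒪 → 𝒪
  conj (mk a b) = mk (a + b) (- b)

  norm : 𝒪 → ℤ
  norm (mk a b) = a * a + a * b - c * b * b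

  *ᴷ-comm : ∀ x y → x *ᴷ y ≡ y *ᴷ x
  *ᴷ-comm (mk a b) (mk a′ b′) = cong₂ mk (re-comm a b a′ b′ c) (im-comm a b a′ b′)
    where
    re-comm : ∀ a b a′ b′ c → a * a′ + b * b′ * c ≡ a′ * a + b′ * b * c
    re-comm = solve-∀
    im-comm : ∀ a b a′ b′ → a * b′ + a′ * b + b * b′ ≡ a′ * b + a * b′ + b′ * b
    im-comm = solve-∀

  *ᴷ-assoc : ∀ x y z → (x *ᴷ y) *ᴷ z ≡ x *ᴷ (y *ᴷ z)
  *ᴷ-assoc (mk a b) (mk a′ b′) (mk a″ b″) = cong₂ mk (re-assoc a b a′ b′ a″ b″ c) (im-assoc a b a′ b′ a″ b″ c)
    where
    re-assoc : ∀ a b a′ b′ a″ b″ c →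
      (a * a′ + b * b′ * c) * a″ + (a * b′ + a′ * b + b * b′) * b″ * c
        ≡ a * (a′ * a″ + b′ * b″ * c) + b * (a′ * b″ + a″ * b′ + b′ * b″) * c
    re-assoc = solve-∀
    im-assoc : ∀ a b a′ b′ a″ b″ c →
      (a * a′ + b * b′ * c) * b″ + a″ * (a * b′ + a′ * b + b * b′) + (a * b′ + a′ * b + b * b′) * b″
        ≡ a * (a′ * b″ + a″ * b′ + b′ * b″) + (a′ * a″ + b′ * b″ * c) * b + b * (a′ * b″ + a″ * b′ + b′ * b″)
    im-assoc = solve-∀

  ι-*ᴷ : ∀ n x → ι n *ᴷ x ≡ mk (n * re x) (n * im x)
  ι-*ᴷ n (mk a b) = cong₂ mk (re-scale n a b c) (im-scale n a b)
    where
    re-scale : ∀ n a b c → n * a + + 0 * b * c ≡ n * a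
    re-scale = solve-∀
    im-scale : ∀ n a b → n * b + a * + 0 + + 0 * b ≡ n * b
    im-scale = solve-∀

  ι-*ᴷ-cancel : ∀ {n} .{{_ : NonZero n}} {x y} → ι n *ᴷ x ≡ ι n *ᴷ y → x ≡ y
  ι-*ᴷ-cancel {n} {mk a b} {mk a′ b′} nx≡ny = cong₂ mk
    (ℤ.*-cancelˡ-≡ n a a′ (cong re scaled)) (ℤ.*-cancelˡ-≡ n b b′ (cong im scaled))
    where scaled = trans (sym (ι-*ᴷ n (mk a b))) (trans nx≡ny (ι-*ᴷ n (mk a′ b′)))

  *ᴷ-conj : ∀ x → x *ᴷ conj x ≡ ι (norm x)
  *ᴷ-conj (mk a b) = cong₂ mk (re-norm a b c) (im-norm a b)
    where
    re-norm : ∀ a b c → a * (a + b) + b * - b * c ≡ a * a + a * b - c * b * b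
    re-norm = solve-∀
    im-norm : ∀ a b → a * - b + (a + b) * b + b * - b ≡ + 0
    im-norm = solve-∀

  norm-*ᴷ : ∀ x y → norm (x *ᴷ y) ≡ norm x * norm y
  norm-*ᴷ (mk a b) (mk a′ b′) = multiplicative a b a′ b′ c
    where
    multiplicative : ∀ a b a′ b′ c →
      let A = a * a′ + b * b′ * c; B = a * b′ + a′ * b + b * b′ in
      A * A + A * B - c * B * B ≡ (a * a + a * b - c * b * b) * (a′ * a′ + a′ * b′ - c * b′ * b′)
    multiplicative = solve-∀

  norm-ι : ∀ n → norm (ι n) ≡ n * n
  norm-ι n = square n c
    where
    square : ∀ n c → n * n + n * + 0 - c * + 0 * + 0 ≡ n * n
    square = solve-∀

  norm-nonNeg : c ≤ -1ℤ → ∀ x → 0ℤ ≤ norm x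
  norm-nonNeg c≤-1 (mk a b) = 0≤2*i⇒0≤i (subst (0ℤ ≤_) (sym (sum-of-squares a b c))
    (ℤ.+-mono-≤ (ℤ.+-mono-≤ (ℤ.+-mono-≤ (0≤i*i a) (0≤i*i b)) (0≤i*i (a + b)))
                (0≤i*j (0≤i*j {+ 2} (+≤+ z≤n) (ℤ.i≤j⇒0≤j-i c≤-1)) (0≤i*i b))))
    where
    sum-of-squares : ∀ a b c → + 2 * (a * a + a * b - c * b * b)
                               ≡ a * a + b * b + (a + b) * (a + b) + + 2 * (-1ℤ - c) * (b * b)
    sum-of-squares = solve-∀

  norm≡1⇒unit : ∀ {x} → norm x ≡ + 1 → IsUnit x
  norm≡1⇒unit {x} N≡1 = conj x , sym (trans (*ᴷ-conj x) (cong ι N≡1))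

  norm-of-prime-factor : c ≤ -1ℤ → ∀ {p} → Prime p → ∀ α ᾱ → α *ᴷ ᾱ ≡ ι (+ p) →
                         ¬ IsUnit α → ¬ IsUnit ᾱ → norm α ≡ + p
  norm-of-prime-factor c≤-1 {p} p-prime α ᾱ αᾱ≡p α-nonunit ᾱ-nonunit =
    trans (sym (+∣norm∣ α))
          (cong +_ (prime-square-factor p-prime ∣norm∣-product (∣norm∣≢1 α α-nonunit) (∣norm∣≢1 ᾱ ᾱ-nonunit)))
    where
    open ≡-Reasoning
    +∣norm∣ : ∀ x → + ∣ norm x ∣ ≡ norm x
    +∣norm∣ x = ℤ.0≤i⇒+∣i∣≡i (norm-nonNeg c≤-1 x)
    ∣norm∣≢1 : ∀ x → ¬ IsUnit x → ∣ norm x ∣ ≢ 1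
    ∣norm∣≢1 x x-nonunit ∣N∣≡1 = x-nonunit (norm≡1⇒unit {x} (trans (sym (+∣norm∣ x)) (cong +_ ∣N∣≡1)))
    ∣norm∣-product : ∣ norm α ∣ ℕ.* ∣ norm ᾱ ∣ ≡ p ℕ.* p
    ∣norm∣-product = begin
      ∣ norm α ∣ ℕ.* ∣ norm ᾱ ∣ ≡⟨ ℤ.abs-* (norm α) (norm ᾱ) ⟨
      ∣ norm α * norm ᾱ ∣       ≡⟨ cong ∣_∣ (norm-*ᴷ α ᾱ) ⟨
      ∣ norm (α *ᴷ ᾱ) ∣         ≡⟨ cong (λ x → ∣ norm x ∣) αᾱ≡p ⟩
      ∣ norm (ι (+ p)) ∣        ≡⟨ cong ∣_∣ (norm-ι (+ p)) ⟩
      ∣ + p * + p ∣             ≡⟨ ℤ.abs-* (+ p) (+ p) ⟩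
      p ℕ.* p                   ∎

  conj-of-prime-factor : ∀ {p} → Prime p → ∀ α ᾱ → norm α ≡ + p → α *ᴷ ᾱ ≡ ι (+ p) → ᾱ ≡ conj α
  conj-of-prime-factor {p} p-prime α ᾱ N≡p αᾱ≡p = ι-*ᴷ-cancel {+ p} {{prime⇒nonZero p-prime}} (begin
    ι (+ p) *ᴷ ᾱ         ≡⟨ cong (λ n → ι n *ᴷ ᾱ) N≡p ⟨
    ι (norm α) *ᴷ ᾱ      ≡⟨ cong (_*ᴷ ᾱ) (*ᴷ-conj α) ⟨
    (α *ᴷ conj α) *ᴷ ᾱ   ≡⟨ cong (_*ᴷ ᾱ) (*ᴷ-comm α (conj α)) ⟩
    (conj α *ᴷ α) *ᴷ ᾱ   ≡⟨ *ᴷ-assoc (conj α) α ᾱ ⟩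
    conj α *ᴷ (α *ᴷ ᾱ)   ≡⟨ cong (conj α *ᴷ_) αᾱ≡p ⟩
    conj α *ᴷ ι (+ p)    ≡⟨ *ᴷ-comm (conj α) (ι (+ p)) ⟩
    ι (+ p) *ᴷ conj α    ∎)
    where open ≡-Reasoning

  module _ {m : ℤ} where

    +ᴷ-cong-mod : ∀ {x x′ y y′} → x ≡ᴷ x′ [mod m ] → y ≡ᴷ y′ [mod m ] → x +ᴷ y ≡ᴷ x′ +ᴷ y′ [mod m ]
    +ᴷ-cong-mod ⟨ a , b ⟩ ⟨ a′ , b′ ⟩ = ⟨ +-cong-mod a a′ , +-cong-mod b b′ ⟩

    -ᴷ-cong-mod : ∀ {x x′} → x ≡ᴷ x′ [mod m ] → -ᴷ x ≡ᴷ -ᴷ x′ [mod m ]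
    -ᴷ-cong-mod ⟨ a , b ⟩ = ⟨ neg-cong-mod a , neg-cong-mod b ⟩

    *ᴷ-cong-mod : ∀ {x x′ y y′} → x ≡ᴷ x′ [mod m ] → y ≡ᴷ y′ [mod m ] → x *ᴷ y ≡ᴷ x′ *ᴷ y′ [mod m ]
    *ᴷ-cong-mod ⟨ a , b ⟩ ⟨ a′ , b′ ⟩ =
      ⟨ +-cong-mod (*-cong-mod a a′) (*-cong-mod (*-cong-mod b b′) (≡-mod-refl c))
      , +-cong-mod (+-cong-mod (*-cong-mod a b′) (*-cong-mod a′ b)) (*-cong-mod b b′) ⟩

    cube-cong-mod : ∀ {x x′} → x ≡ᴷ x′ [mod m ] → cube x ≡ᴷ cube x′ [mod m ]
    cube-cong-mod x≡x′ = *ᴷ-cong-mod (*ᴷ-cong-mod x≡x′ x≡x′) x≡x′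

    conj-cong-mod : ∀ {x x′} → x ≡ᴷ x′ [mod m ] → conj x ≡ᴷ conj x′ [mod m ]
    conj-cong-mod ⟨ a , b ⟩ = ⟨ +-cong-mod a b , neg-cong-mod b ⟩

    norm-cong-mod : ∀ {x x′} → x ≡ᴷ x′ [mod m ] → norm x ≡ norm x′ [mod m ]
    norm-cong-mod ⟨ a , b ⟩ = +-cong-mod (+-cong-mod (*-cong-mod a a) (*-cong-mod a b))
                                         (neg-cong-mod (*-cong-mod (*-cong-mod (≡-mod-refl c) b) b))

    linProd-cong-mod : ∀ {r r′ s s′} → r ≡ᴷ r′ [mod m ] → s ≡ᴷ s′ [mod m ] →
                       linProd r s ≡ᴾ linProd r′ s′ [mod m ]
    linProd-cong-mod r≡r′ s≡s′ = ⟨ -ᴷ-cong-mod (+ᴷ-cong-mod r≡r′ s≡s′) , *ᴷ-cong-mod r≡r′ s≡s′ ⟩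

  ι-*ᴷ-scale-mod : ∀ k {m x y} → x ≡ᴷ y [mod m ] → ι k *ᴷ x ≡ᴷ ι k *ᴷ y [mod k * m ]
  ι-*ᴷ-scale-mod k {m} {x} {y} ⟨ a , b ⟩ =
    subst₂ (λ u v → u ≡ᴷ v [mod k * m ]) (sym (ι-*ᴷ k x)) (sym (ι-*ᴷ k y))
           ⟨ *-scale-mod k a , *-scale-mod k b ⟩

  ∣ᴷ⇒≡ᴷ : ∀ {m x y} → ι m ∣ᴷ (x -ᴷ y) → x ≡ᴷ y [mod m ]
  ∣ᴷ⇒≡ᴷ {m} (q , x-y≡mq) =
    ⟨ congruent (divides (re q) (trans (cong re scaled) (ℤ.*-comm m (re q))))
    , congruent (divides (im q) (trans (cong im scaled) (ℤ.*-comm m (im q)))) ⟩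
    where scaled = trans x-y≡mq (ι-*ᴷ m q)

  ≡ᴷ⇒∣ᴷ : ∀ {m x y} → x ≡ᴷ y [mod m ] → ι m ∣ᴷ (x -ᴷ y)
  ≡ᴷ⇒∣ᴷ {m} ⟨ congruent (divides q₁ re≡) , congruent (divides q₂ im≡) ⟩ =
    mk q₁ q₂ , trans (cong₂ mk (trans re≡ (ℤ.*-comm q₁ m)) (trans im≡ (ℤ.*-comm q₂ m)))
                     (sym (ι-*ᴷ m (mk q₁ q₂)))

  ≡ᴾ⇒≡Q₈ : ∀ {P Q} → P ≡ᴾ Q [mod + 8 ] → P ≡Q₈ Q
  ≡ᴾ⇒≡Q₈ ⟨ b≡b′ , c≡c′ ⟩ = ≡ᴷ⇒∣ᴷ b≡b′ , ≡ᴷ⇒∣ᴷ c≡c′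

  Any-≡ᴾ⇒≡Q₈ : ∀ {P qs} → Any (λ q → P ≡ᴾ q [mod + 8 ]) qs → Any (λ q → P ≡Q₈ q) qs
  Any-≡ᴾ⇒≡Q₈ = Any.map ≡ᴾ⇒≡Q₈

  -- Reduction to residues modulo 8

  OddNorm : 𝒪 → Set
  OddNorm x = ¬ norm x ≡ 0ℤ [mod + 2 ]

  Φ₃ : 𝒪 → 𝒪
  Φ₃ z = z *ᴷ z +ᴷ z +ᴷ ι (+ 1)

  Isζ₃ : ℤ → 𝒪 → Set
  Isζ₃ m z = Φ₃ z ≡ᴷ ι (+ 0) [mod m ]

  CubeSumCongruence : 𝒪 → 𝒪 → Set
  CubeSumCongruence x y = Any (λ q → linProd (cube x) (cube y) ≡ᴾ q [mod + 8 ]) list₁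

  CubeDifferenceCongruence : 𝒪 → 𝒪 → 𝒪 → Set
  CubeDifferenceCongruence x y z = Any (λ q → linProd (cube x) (-ᴷ cube y) ≡ᴾ q [mod + 8 ]) (list₂ z)

  oddNorm? : ∀ x → Dec (OddNorm x)
  oddNorm? x = ¬? (norm x ≡? 0ℤ [mod + 2 ])

  isζ₃? : ∀ m z → Dec (Isζ₃ m z)
  isζ₃? m z = Φ₃ z ≡ᴷ? ι (+ 0) [mod m ]

  cubeSumCongruence? : ∀ x y → Dec (CubeSumCongruence x y)
  cubeSumCongruence? x y = any? (λ q → linProd (cube x) (cube y) ≡ᴾ? q [mod + 8 ]) list₁

  cubeDifferenceCongruence? : ∀ x y z → Dec (CubeDifferenceCongruence x y z)
  cubeDifferenceCongruence? x y z = any? (λ q → linProd (cube x) (-ᴷ cube y) ≡ᴾ? q [mod + 8 ]) (list₂ z)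

  record FiniteChecks : Set where
    constructor finiteChecks
    field
      imaginary       : c ≤ -1ℤ
      two-inert       : ∀ (r s : Fin 8) → ¬ norm (residue r s) ≡ + 2 [mod + 8 ]
      cube-sum        : ∀ (r s : Fin 8) → let x = residue r s in
                        OddNorm x → CubeSumCongruence x (conj x)
      cube-difference : ∀ (r s : Fin 8) (t u : Fin 2) → let x = residue r s; w = residue t u in
                        Isζ₃ (+ 2) w → OddNorm x → CubeDifferenceCongruence x (conj x) w

  finiteChecks? : Dec FiniteChecks
  finiteChecks? = Dec.map′ (λ (i , t , s , d) → finiteChecks i t s d)
                           (λ (finiteChecks i t s d) → i , t , s , d)
    (c ℤ.≤? -1ℤ
      ×-dec (Fin.all? λ r → Fin.all? λ s → ¬? (norm (residue r s) ≡? + 2 [mod + 8 ]))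
      ×-dec (Fin.all? λ r → Fin.all? λ s → let x = residue r s in
               oddNorm? x →-dec cubeSumCongruence? x (conj x))
      ×-dec (Fin.all? λ r → Fin.all? λ s → Fin.all? λ t → Fin.all? λ u →
               let x = residue r s; w = residue t u in
               isζ₃? (+ 2) w →-dec oddNorm? x →-dec cubeDifferenceCongruence? x (conj x) w))

  oddNorm-resp : ∀ {x y} → x ≡ᴷ y [mod + 8 ] → OddNorm x → OddNorm y
  oddNorm-resp x≡y x-odd Ny≡0 = x-odd (≡-mod-trans (≡-mod-weaken 2∣8 (norm-cong-mod x≡y)) Ny≡0)

  isζ₃-resp : ∀ {m z w} → z ≡ᴷ w [mod m ] → Isζ₃ m z → Isζ₃ m w
  isζ₃-resp z≡w = ≡ᴷ-mod-trans (Φ₃-cong-mod (≡ᴷ-mod-sym z≡w))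
    where
    Φ₃-cong-mod : ∀ {m w z} → w ≡ᴷ z [mod m ] → Φ₃ w ≡ᴷ Φ₃ z [mod m ]
    Φ₃-cong-mod w≡z = +ᴷ-cong-mod (+ᴷ-cong-mod (*ᴷ-cong-mod w≡z w≡z) w≡z) (≡ᴷ-mod-refl (ι (+ 1)))

  list₂-cong-mod : ∀ {w z} → w ≡ᴷ z [mod + 2 ] → Pointwise (λ P Q → P ≡ᴾ Q [mod + 8 ]) (list₂ w) (list₂ z)
  list₂-cong-mod w≡z =
    ≡ᴾ-mod-refl _ ∷ ⟨ 4w+2 , ≡ᴷ-mod-refl _ ⟩ ∷ ⟨ 4w-2 , ≡ᴷ-mod-refl _ ⟩ ∷
    ≡ᴾ-mod-refl _ ∷ ⟨ 4w+2 , ≡ᴷ-mod-refl _ ⟩ ∷ ⟨ 4w-2 , ≡ᴷ-mod-refl _ ⟩ ∷ []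
    where
    4w≡4z = ι-*ᴷ-scale-mod (+ 4) w≡z
    4w+2 = +ᴷ-cong-mod 4w≡4z (≡ᴷ-mod-refl (k (+ 2)))
    4w-2 = +ᴷ-cong-mod 4w≡4z (≡ᴷ-mod-refl (-ᴷ k (+ 2)))

  module _ (checks : FiniteChecks) where
    open FiniteChecks checks

    norm≢2 : ∀ x → ¬ norm x ≡ + 2 [mod + 8 ]
    norm≢2 x N≡2 = let (r , s , x≡rs) = residue-of 8 x in
      two-inert r s (≡-mod-trans (≡-mod-sym (norm-cong-mod x≡rs)) N≡2)

    prime-norm-odd : ∀ {p} x → Prime p → norm x ≡ + p → OddNorm x
    prime-norm-odd {p} x p-prime N≡p (congruent 2∣N-0) =
      norm≢2 x (≡-mod-reflexive (trans N≡p (cong +_ (even-prime≡2 p-prime (∣⇒∣ᵤ 2∣p)))))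
      where
      2∣p : + 2 ∣ + p
      2∣p = subst (+ 2 ∣_) (trans (ℤ.+-identityʳ (norm x)) N≡p) 2∣N-0

    cube-sum-congruence : ∀ x → OddNorm x → CubeSumCongruence x (conj x)
    cube-sum-congruence x x-odd = let (r , s , x≡rs) = residue-of 8 x in
      Any.map (≡ᴾ-mod-trans (linProd-cong-mod (cube-cong-mod x≡rs) (cube-cong-mod (conj-cong-mod x≡rs))))
              (cube-sum r s (oddNorm-resp x≡rs x-odd))

    cube-difference-congruence : ∀ x z → Isζ₃ (+ 8) z → OddNorm x → CubeDifferenceCongruence x (conj x) z
    cube-difference-congruence x z z-root x-odd =
      let (r , s , x≡rs) = residue-of 8 x
          (t , u , z≡tu) = residue-of 2 z
          x³≡r³ = cube-cong-mod x≡rs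
          x̄³≡r̄³ = cube-cong-mod (conj-cong-mod x≡rs)
      in Any-resp-Pointwise (λ q≡q′ L≡q → ≡ᴾ-mod-trans L≡q q≡q′) (list₂-cong-mod (≡ᴷ-mod-sym z≡tu))
           (Any.map (≡ᴾ-mod-trans (linProd-cong-mod x³≡r³ (-ᴷ-cong-mod x̄³≡r̄³)))
                    (cube-difference r s t u (isζ₃-resp z≡tu (≡ᴷ-mod-weaken 2∣8 z-root))
                                     (oddNorm-resp x≡rs x-odd)))

    cube-congruences : ∀ {p} → Prime p → ∀ α ᾱ → α *ᴷ ᾱ ≡ ι (+ p) → ¬ IsUnit α → ¬ IsUnit ᾱ →
                       ∀ z → Isζ₃ (+ 8) z → CubeSumCongruence α ᾱ × CubeDifferenceCongruence α ᾱ z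
    cube-congruences p-prime α ᾱ αᾱ≡p α-nonunit ᾱ-nonunit z z-root =
      subst (λ β → CubeSumCongruence α β × CubeDifferenceCongruence α β z) (sym ᾱ≡conj-α)
            (cube-sum-congruence α α-odd , cube-difference-congruence α z z-root α-odd)
      where
      N≡p = norm-of-prime-factor imaginary p-prime α ᾱ αᾱ≡p α-nonunit ᾱ-nonunit
      ᾱ≡conj-α = conj-of-prime-factor p-prime α ᾱ N≡p αᾱ≡p
      α-odd = prime-norm-odd α p-prime N≡p

heegner-checks : All RingOfIntegers.FiniteChecks heegnerDs
heegner-checks = from-yes (All.all? RingOfIntegers.finiteChecks? heegnerDs)

lemma4p1 : (D : ℤ) → D ∈ heegnerDs →
    let open OK D in
    (p : ℕ) → Prime p →
    (α ᾱ : 𝒪) → α *ᴷ ᾱ ≡ ι (+ p) →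
    PrincipalPrime α → PrincipalPrime ᾱ → ¬ SameIdeal α ᾱ →
    (z : 𝒪) → (z *ᴷ z +ᴷ z +ᴷ ι (+ 1)) ≡₈ ι (+ 0) →
    Any (λ q → linProd (cube α) (cube ᾱ) ≡Q₈ q) list₁
      × Any (λ q → linProd (cube α) (-ᴷ cube ᾱ) ≡Q₈ q) (list₂ z)
lemma4p1 D D∈ p p-prime α ᾱ αᾱ≡p (α-nonunit , _) (ᾱ-nonunit , _) _ z z-root =
  let open RingOfIntegers D
      checks = All.lookup heegner-checks D∈
      (sum , difference) = cube-congruences checks p-prime α ᾱ αᾱ≡p α-nonunit ᾱ-nonunit z (∣ᴷ⇒≡ᴷ z-root)
  in Any-≡ᴾ⇒≡Q₈ sum , Any-≡ᴾ⇒≡Q₈ difference
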